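{- Let $\pi$ be a sum indecomposable permutation of $[N]$ avoiding $2341$, $4123$ and $3412$. Then the inflection points of $\pi$ (of both types), listed in increasing order of their first coordinate, have strictly increasing second coordinates, and the inflection points associated with left-to-right maxima alternate with those associated with right-to-left minima.
   Context: A permutation $\pi$ contains $\tau$ if $\pi$ has a subsequence order-isomorphic to $\tau$; otherwise it avoids $\tau$. For permutations $\sigma$ of $[k]$ and $\tau$ of $[l]$, $12[\sigma,\tau]$ is the permutation $\sigma(1)\cdots\sigma(k)(\tau(1)+k)\cdots(\tau(l)+k)$; a permutation is sum decomposable if it equals $12[\sigma,\tau]$ for nonempty $\sigma,\tau$, and sum indecomposable otherwise. An entry $\pi(j)$ is a left-to-right maximum if $\pi(j)>\pi(i)$ for all $i<j$, and a right-to-left minimum if $\pi(j)<\pi(k)$ for all $k>j$. Identify the entry $\pi(i)$ with the point $(i,\pi(i))$. If the left-to-right maxima are at positions $i_1<\dots<i_a$, the inflection points associated with left-to-right maxima are $(i_{r+1},\pi(i_r))$ for $1\le r<a$. If the right-to-left minima are at positions $j_1<\dots<j_b$, the inflection points associated with right-to-left minima are $(j_r,\pi(j_{r+1}))$ for $1\le r<b$. (These are the corners of the staircase paths joining consecutive left-to-right maxima, and consecutive right-to-left minima, by horizontal and vertical segments.) -}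

module Defs where

open import Data.Nat using (ℕ; zero; suc; _+_; _≥_)
open import Data.Fin using (Fin; zero; suc; _<_; cast; splitAt; _↑ˡ_; _↑ʳ_)
open import Data.Fin.Permutation using (Permutation′; _⟨$⟩ʳ_)
open import Data.Empty using (⊥)
open import Data.Sum using (_⊎_; [_,_])
open import Data.Product using (Σ; _×_; ∃; proj₁; proj₂)
open import Data.Vec using (Vec; lookup; _∷_; [])
open import Relation.Binary.PropositionalEquality using (_≡_; sym)

-- Conventions: [N] is represented by Fin N (0-based); a permutation of [N]
-- is a bijection Fin N ↔ Fin N (Data.Fin.Permutation); the entry π(i) is
-- identified with the point (i , π i).

Contains : ∀ {N k} → Permutation′ N → (Fin k → Fin k) → Set
Contains {N} {k} π τ =
  Σ (Fin k → Fin N) λ f →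
    (∀ a b → a < b → f a < f b) ×
    (∀ a b → (τ a < τ b → π ⟨$⟩ʳ f a < π ⟨$⟩ʳ f b) ×
             (π ⟨$⟩ʳ f a < π ⟨$⟩ʳ f b → τ a < τ b))

Avoids : ∀ {N k} → Permutation′ N → (Fin k → Fin k) → Set
Avoids π τ = Contains π τ → ⊥

-- Patterns (one-line notation shifted to 0-based values)
p2341 p4123 p3412 : Fin 4 → Fin 4
p2341 i = lookup (suc zero ∷ suc (suc zero) ∷ suc (suc (suc zero)) ∷ zero ∷ []) i
p4123 i = lookup (suc (suc (suc zero)) ∷ zero ∷ suc zero ∷ suc (suc zero) ∷ []) i
p3412 i = lookup (suc (suc zero) ∷ suc (suc (suc zero)) ∷ zero ∷ suc zero ∷ []) i

sum12 : ∀ {k l} → Permutation′ k → Permutation′ l → Fin (k + l) → Fin (k + l)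
sum12 {k} {l} σ τ i = [ (λ a → (σ ⟨$⟩ʳ a) ↑ˡ l) , (λ b → k ↑ʳ (τ ⟨$⟩ʳ b)) ] (splitAt k i)

SumDecomposable : ∀ {N} → Permutation′ N → Set
SumDecomposable {N} π =
  Σ ℕ λ k → Σ ℕ λ l → Σ (k + l ≡ N) λ e →
  Σ (Permutation′ k) λ σ → Σ (Permutation′ l) λ τ →
    k ≥ 1 × l ≥ 1 ×
    (∀ i → π ⟨$⟩ʳ i ≡ cast e (sum12 σ τ (cast (sym e) i)))

SumIndecomposable : ∀ {N} → Permutation′ N → Set
SumIndecomposable π = SumDecomposable π → ⊥

IsLRMax : ∀ {N} → Permutation′ N → Fin N → Set
IsLRMax π j = ∀ i → i < j → π ⟨$⟩ʳ i < π ⟨$⟩ʳ j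

IsRLMin : ∀ {N} → Permutation′ N → Fin N → Set
IsRLMin π j = ∀ k → j < k → π ⟨$⟩ʳ j < π ⟨$⟩ʳ k

ConsecLRMax : ∀ {N} → Permutation′ N → Fin N → Fin N → Set
ConsecLRMax π i i' = IsLRMax π i × IsLRMax π i' × i < i' ×
  (∀ m → i < m → m < i' → IsLRMax π m → ⊥)

ConsecRLMin : ∀ {N} → Permutation′ N → Fin N → Fin N → Set
ConsecRLMin π j j' = IsRLMin π j × IsRLMin π j' × j < j' ×
  (∀ m → j < m → m < j' → IsRLMin π m → ⊥)

Point : ℕ → Set
Point N = Fin N × Fin N

data Kind : Set where
  LRmax RLmin : Kind

Inflection : ∀ {N} → Permutation′ N → Kind → Point N → Set
Inflection {N} π LRmax p = Σ (Fin N) λ i → Σ (Fin N) λ i' →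
  ConsecLRMax π i i' × proj₁ p ≡ i' × proj₂ p ≡ π ⟨$⟩ʳ i
Inflection {N} π RLmin p = Σ (Fin N) λ j → Σ (Fin N) λ j' →
  ConsecRLMin π j j' × proj₁ p ≡ j × proj₂ p ≡ π ⟨$⟩ʳ j'

module Submission where

-- An indecomposable permutation has no cut: no 0 < k < N such that every entry left of
-- position k is smaller than every entry from k on; each claim follows by exhibiting such a
-- cut or a forbidden pattern.  Between consecutive left-to-right maxima a < b, a not the
-- first, lies a right-to-left minimum: the smallest entry after a is below the largest entry
-- before a (else a cuts), so it lies before b, as beyond b those two entries with a and b
-- would form a 2341.  Dually, by 4123, consecutive right-to-left minima enclose a
-- left-to-right maximum; this gives the alternation.  For the monotonicity, an inflection
-- point (i′, π i) followed by (j, π j′) with π i > π j′ makes i i′ j j′ a 3412, and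
-- (j, π j′) followed by (i′, π i) with π j′ > π i makes i′ a cut.

open import Data.Empty using (⊥; ⊥-elim)
open import Data.Fin as Fin
  using (Fin; zero; suc; #_; toℕ; fromℕ<; inject≤; _↑ˡ_; _↑ʳ_; splitAt; _<_; _≤_)
import Data.Fin.Properties as Fin
open import Data.Fin.Permutation
  using (Permutation′; _⟨$⟩ʳ_; _⟨$⟩ˡ_; inverseˡ; inverseʳ; permutation; flip)
open import Data.List using (List; filter; allFin)
import Data.List.Extrema
open import Data.List.Membership.Propositional using (_∈_)
open import Data.List.Membership.Propositional.Properties using (∈-filter⁺; ∈-allFin)
open import Data.List.Relation.Unary.All using (lookup)
open import Data.List.Relation.Unary.All.Properties using (all-filter)
open import Data.Nat as ℕ using (ℕ; suc; _+_; z≤n; s≤s)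
import Data.Nat.Properties as ℕ
open import Data.Product using (Σ; _×_; _,_; proj₁; proj₂)
open import Data.Sum as Sum using (_⊎_; inj₁; inj₂; [_,_]′)
open import Data.Vec as Vec using (_∷_; [])
open import Function using (_∘_; Injection)
open import Function.Definitions using (Injective)
open import Function.Properties.Inverse using (Inverse⇒Injection)
open import Relation.Binary.Definitions using (tri<; tri≈; tri>)
open import Relation.Binary.PropositionalEquality
  using (_≡_; _≢_; refl; sym; trans; cong; subst; subst₂)
open import Relation.Nullary using (¬_; yes; no)
open import Relation.Nullary.Decidable using (from-yes)
open import Relation.Unary using (Pred; Decidable)

open import Defs

module Extrema = Data.List.Extrema ℕ.≤-totalOrder

bounded-injection⇒≤ : ∀ {m n b} (g : Fin m → Fin n) → Injective _≡_ _≡_ g →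
                      (∀ a → toℕ (g a) ℕ.< b) → m ℕ.≤ b
bounded-injection⇒≤ g g-injective g<b =
  Fin.injective⇒≤ {f = λ a → fromℕ< (g<b a)} λ {a} {a′} eq →
    g-injective (Fin.toℕ-injective (Fin.fromℕ<-injective _ _ (g<b a) (g<b a′) eq))

⟨$⟩ʳ-injective : ∀ {n} (π : Permutation′ n) → Injective _≡_ _≡_ (π ⟨$⟩ʳ_)
⟨$⟩ʳ-injective π = Injection.injective (Inverse⇒Injection π)

⟨$⟩ˡ-injective : ∀ {n} (π : Permutation′ n) → Injective _≡_ _≡_ (π ⟨$⟩ˡ_)
⟨$⟩ˡ-injective π = Injection.injective (Inverse⇒Injection (flip π))

restrict : ∀ {m n} (π : Permutation′ n) (e : Fin m → Fin n) → Injective _≡_ _≡_ e →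
           (f g : Fin m → Fin m) → (∀ a → e (f a) ≡ π ⟨$⟩ʳ e a) → (∀ a → e (g a) ≡ π ⟨$⟩ˡ e a) →
           Permutation′ m
restrict π e e-injective f g e∘f e∘g = permutation f g
  (λ b → e-injective (trans (e∘f (g b)) (trans (cong (π ⟨$⟩ʳ_) (e∘g b)) (inverseʳ π))))
  (λ a → e-injective (trans (e∘g (f a)) (trans (cong (π ⟨$⟩ˡ_) (e∘f a)) (inverseˡ π))))

Cut : ∀ {n} → Permutation′ n → ℕ → Set
Cut π k = ∀ x y → toℕ x ℕ.< k → k ℕ.≤ toℕ y → toℕ (π ⟨$⟩ʳ x) ℕ.< toℕ (π ⟨$⟩ʳ y)

module _ {k l : ℕ} (π : Permutation′ (k + l)) (cut : Cut π k) where

  private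
    value : Fin (k + l) → ℕ
    value x = toℕ (π ⟨$⟩ʳ x)

    ↑ˡ-left : ∀ (a : Fin k) → toℕ (a ↑ˡ l) ℕ.< k
    ↑ˡ-left a = subst (ℕ._< k) (sym (Fin.toℕ-↑ˡ a l)) (Fin.toℕ<n a)

    ↑ʳ-right : ∀ (b : Fin l) → k ℕ.≤ toℕ (k ↑ʳ b)
    ↑ʳ-right b = subst (k ℕ.≤_) (sym (Fin.toℕ-↑ʳ k b)) (ℕ.m≤m+n k (toℕ b))

    fromℕ<-↑ˡ : ∀ {x : Fin (k + l)} (x<k : toℕ x ℕ.< k) → fromℕ< x<k ↑ˡ l ≡ x
    fromℕ<-↑ˡ {x} x<k = Fin.splitAt⁻¹-↑ˡ (Fin.splitAt-< k x x<k)

    ↑ʳ-reduce≥ : ∀ {x : Fin (k + l)} (k≤x : k ℕ.≤ toℕ x) → k ↑ʳ Fin.reduce≥ x k≤x ≡ x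
    ↑ʳ-reduce≥ {x} k≤x = Fin.splitAt⁻¹-↑ʳ (Fin.splitAt-≥ k x k≤x)

  -- The positions of the values 0, …, π x₀ all lie left of the cut.
  cut-value< : ∀ x → toℕ x ℕ.< k → value x ℕ.< k
  cut-value< x₀ x₀<k = bounded-injection⇒≤ preimage
    (λ eq → Fin.inject≤-injective _ _ _ _ (⟨$⟩ˡ-injective π eq)) preimage<k
    where
      v₀<n : value x₀ ℕ.< k + l
      v₀<n = Fin.toℕ<n (π ⟨$⟩ʳ x₀)
      preimage : Fin (suc (value x₀)) → Fin (k + l)
      preimage w = π ⟨$⟩ˡ inject≤ w v₀<n
      preimage-value≤ : ∀ w → value (preimage w) ℕ.≤ value x₀
      preimage-value≤ w = begin
        value (preimage w)    ≡⟨ cong toℕ (inverseʳ π) ⟩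
        toℕ (inject≤ w v₀<n)  ≡⟨ Fin.toℕ-inject≤ w v₀<n ⟩
        toℕ w                 ≤⟨ ℕ.s≤s⁻¹ (Fin.toℕ<n w) ⟩
        value x₀              ∎
        where open ℕ.≤-Reasoning
      preimage<k : ∀ w → toℕ (preimage w) ℕ.< k
      preimage<k w = ℕ.≰⇒> λ k≤p → ℕ.<⇒≱ (cut x₀ (preimage w) x₀<k k≤p) (preimage-value≤ w)

  -- Otherwise the k entries left of the cut would all lie below w₀ < k.
  cut-preimage< : ∀ w → toℕ w ℕ.< k → toℕ (π ⟨$⟩ˡ w) ℕ.< k
  cut-preimage< w₀ w₀<k = ℕ.≰⇒> λ k≤p → ℕ.<⇒≱ w₀<k (bounded-injection⇒≤ image
    (λ eq → Fin.↑ˡ-injective l _ _ (⟨$⟩ʳ-injective π eq)) (image<w₀ k≤p))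
    where
      image : Fin k → Fin (k + l)
      image a = π ⟨$⟩ʳ (a ↑ˡ l)
      image<w₀ : k ℕ.≤ toℕ (π ⟨$⟩ˡ w₀) → ∀ a → toℕ (image a) ℕ.< toℕ w₀
      image<w₀ k≤p a = subst (value (a ↑ˡ l) ℕ.<_) (cong toℕ (inverseʳ π))
                             (cut (a ↑ˡ l) (π ⟨$⟩ˡ w₀) (↑ˡ-left a) k≤p)

  cut-value≥ : ∀ x → k ℕ.≤ toℕ x → k ℕ.≤ value x
  cut-value≥ x k≤x = ℕ.≮⇒≥ λ v<k →
    ℕ.<⇒≱ (subst (ℕ._< k) (cong toℕ (inverseˡ π)) (cut-preimage< (π ⟨$⟩ʳ x) v<k)) k≤x

  cut-preimage≥ : ∀ w → k ℕ.≤ toℕ w → k ℕ.≤ toℕ (π ⟨$⟩ˡ w)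
  cut-preimage≥ w k≤w = ℕ.≮⇒≥ λ p<k →
    ℕ.<⇒≱ (subst (ℕ._< k) (cong toℕ (inverseʳ π)) (cut-value< (π ⟨$⟩ˡ w) p<k)) k≤w

  private
    left-image : ∀ a → toℕ (π ⟨$⟩ʳ (a ↑ˡ l)) ℕ.< k
    left-image a = cut-value< (a ↑ˡ l) (↑ˡ-left a)

    right-image : ∀ b → k ℕ.≤ toℕ (π ⟨$⟩ʳ (k ↑ʳ b))
    right-image b = cut-value≥ (k ↑ʳ b) (↑ʳ-right b)

  cut-left : Permutation′ k
  cut-left = restrict π (_↑ˡ l) (λ {a} {a′} → Fin.↑ˡ-injective l a a′) to from
    (λ a → fromℕ<-↑ˡ (left-image a)) (λ a → fromℕ<-↑ˡ (left-preimage a))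
    where
      left-preimage : ∀ a → toℕ (π ⟨$⟩ˡ (a ↑ˡ l)) ℕ.< k
      left-preimage a = cut-preimage< (a ↑ˡ l) (↑ˡ-left a)
      to from : Fin k → Fin k
      to a = fromℕ< (left-image a)
      from a = fromℕ< (left-preimage a)

  cut-right : Permutation′ l
  cut-right = restrict π (k ↑ʳ_) (λ {b} {b′} → Fin.↑ʳ-injective k b b′) to from
    (λ b → ↑ʳ-reduce≥ (right-image b)) (λ b → ↑ʳ-reduce≥ (right-preimage b))
    where
      right-preimage : ∀ b → k ℕ.≤ toℕ (π ⟨$⟩ˡ (k ↑ʳ b))
      right-preimage b = cut-preimage≥ (k ↑ʳ b) (↑ʳ-right b)
      to from : Fin l → Fin l
      to b = Fin.reduce≥ (π ⟨$⟩ʳ (k ↑ʳ b)) (right-image b)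
      from b = Fin.reduce≥ (π ⟨$⟩ˡ (k ↑ʳ b)) (right-preimage b)

  cut-sum12 : ∀ i → π ⟨$⟩ʳ i ≡ sum12 cut-left cut-right i
  cut-sum12 i with splitAt k i in eq
  ... | inj₁ a = trans (cong (π ⟨$⟩ʳ_) (sym (Fin.splitAt⁻¹-↑ˡ eq)))
                       (sym (fromℕ<-↑ˡ (left-image a)))
  ... | inj₂ b = trans (cong (π ⟨$⟩ʳ_) (sym (Fin.splitAt⁻¹-↑ʳ eq)))
                       (sym (↑ʳ-reduce≥ (right-image b)))

cut⇒sumDecomposable : ∀ {n} (π : Permutation′ n) k → 1 ℕ.≤ k → k ℕ.< n → Cut π k →
                      SumDecomposable π
cut⇒sumDecomposable {n} π k 1≤k k<n =
  decompose (ℕ.m+[n∸m]≡n (ℕ.<⇒≤ k<n)) π (ℕ.m<n⇒0<n∸m k<n)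
  where
    decompose : ∀ {l m} → k + l ≡ m → (π : Permutation′ m) → 1 ℕ.≤ l → Cut π k →
                SumDecomposable π
    decompose {l} refl π 1≤l cut = k , l , refl , σ , τ , 1≤k , 1≤l , λ i →
      trans (cut-sum12 π cut i)
            (sym (trans (Fin.cast-is-id refl _) (cong (sum12 σ τ) (Fin.cast-is-id refl i))))
      where
        σ = cut-left π cut
        τ = cut-right π cut

module _ {n p} (f : Fin n → ℕ) {P : Pred (Fin n) p} (P? : Decidable P)
         {x₀ : Fin n} (px₀ : P x₀) where

  private
    candidates : List (Fin n)
    candidates = filter P? (allFin n)

    candidate : ∀ {x} → P x → x ∈ candidates
    candidate {x} px = ∈-filter⁺ P? (∈-allFin x) px

  argmax-on : Σ (Fin n) λ c → P c × (∀ x → P x → f x ℕ.≤ f c)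
  argmax-on = Extrema.argmax f x₀ candidates
            , Extrema.argmax-all f px₀ (all-filter P? (allFin n))
            , λ x px → lookup (Extrema.f[xs]≤f[argmax] x₀ candidates) (candidate px)

  argmin-on : Σ (Fin n) λ c → P c × (∀ x → P x → f c ℕ.≤ f x)
  argmin-on = Extrema.argmin f x₀ candidates
            , Extrema.argmin-all f px₀ (all-filter P? (allFin n))
            , λ x px → lookup (Extrema.f[argmin]≤f[xs] x₀ candidates) (candidate px)

≤⇒<⊎≡ : ∀ {n} {a b : Fin n} → a ≤ b → a < b ⊎ a ≡ b
≤⇒<⊎≡ a≤b = Sum.map₂ Fin.toℕ-injective (ℕ.m≤n⇒m<n∨m≡n a≤b)

Ascending : ∀ {n} → (Fin (suc n) → ℕ) → Set
Ascending {n} h = ∀ (i : Fin n) → h (Fin.inject₁ i) ℕ.< h (suc i)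

ascending⇒increasing : ∀ {n} (h : Fin (suc n) → ℕ) → Ascending h →
                       ∀ {i j : Fin (suc n)} → i < j → h i ℕ.< h j
ascending⇒increasing {suc n} h asc {zero} {suc zero} _ = asc zero
ascending⇒increasing {suc n} h asc {zero} {suc (suc j)} _ =
  ℕ.<-trans (asc zero) (ascending⇒increasing (h ∘ suc) (asc ∘ suc) {zero} {suc j} (s≤s z≤n))
ascending⇒increasing {suc n} h asc {suc i} {suc j} (s≤s i<j) =
  ascending⇒increasing (h ∘ suc) (asc ∘ suc) i<j

ascending₄ : (h : Fin 4 → ℕ) → h (# 0) ℕ.< h (# 1) → h (# 1) ℕ.< h (# 2) → h (# 2) ℕ.< h (# 3) →
             Ascending h
ascending₄ h h₀<h₁ _ _ zero = h₀<h₁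
ascending₄ h _ h₁<h₂ _ (suc zero) = h₁<h₂
ascending₄ h _ _ h₂<h₃ (suc (suc zero)) = h₂<h₃

occurrence : ∀ {N n} (π : Permutation′ N) (τ τ⁻¹ : Fin (suc n) → Fin (suc n)) →
             (∀ a → τ⁻¹ (τ a) ≡ a) → (c : Fin (suc n) → Fin N) → Ascending (toℕ ∘ c) →
             Ascending (λ i → toℕ (π ⟨$⟩ʳ c (τ⁻¹ i))) → Contains π τ
occurrence {n = n} π τ τ⁻¹ τ⁻¹∘τ c c↑ πc↑ =
  c , (λ a b → ascending⇒increasing (toℕ ∘ c) c↑) , λ a b → forward a b , backward a b
  where
    value : Fin (suc n) → ℕ
    value a = toℕ (π ⟨$⟩ʳ c a)
    forward : ∀ a b → τ a < τ b → value a ℕ.< value b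
    forward a b lt = subst₂ ℕ._<_ (cong value (τ⁻¹∘τ a)) (cong value (τ⁻¹∘τ b))
                       (ascending⇒increasing (value ∘ τ⁻¹) πc↑ lt)
    τ-injective : ∀ {a b} → τ a ≡ τ b → a ≡ b
    τ-injective {a} {b} eq = trans (sym (τ⁻¹∘τ a)) (trans (cong τ⁻¹ eq) (τ⁻¹∘τ b))
    backward : ∀ a b → value a ℕ.< value b → τ a < τ b
    backward a b lt with Fin.<-cmp (τ a) (τ b)
    ... | tri< τa<τb _ _ = τa<τb
    ... | tri≈ _ τa≡τb _ = ⊥-elim (ℕ.<-irrefl (cong value (τ-injective τa≡τb)) lt)
    ... | tri> _ _ τb<τa = ⊥-elim (ℕ.<-asym lt (forward b a τb<τa))

module Records {N} (π : Permutation′ N) where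

  value : Fin N → ℕ
  value x = toℕ (π ⟨$⟩ʳ x)

  value-≤∧≢⇒< : ∀ {x y : Fin N} → x ≢ y → value x ℕ.≤ value y → value x ℕ.< value y
  value-≤∧≢⇒< x≢y v≤ = ℕ.≤∧≢⇒< v≤ (λ eq → x≢y (⟨$⟩ʳ-injective π (Fin.toℕ-injective eq)))

  value-mono-≤ : ∀ {x y : Fin N} → (x < y → value x ℕ.< value y) → x ≤ y → value x ℕ.≤ value y
  value-mono-≤ mono x≤y = [ ℕ.<⇒≤ ∘ mono , ℕ.≤-reflexive ∘ cong value ]′ (≤⇒<⊎≡ x≤y)

  LRMax-mono : ∀ {x y : Fin N} → IsLRMax π y → x ≤ y → value x ℕ.≤ value y
  LRMax-mono {x} lr = value-mono-≤ (lr x)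

  RLMin-mono : ∀ {x y : Fin N} → IsRLMin π x → x ≤ y → value x ℕ.≤ value y
  RLMin-mono {y = y} rl = value-mono-≤ (rl y)

  prefixMax : ∀ {x₀ i : Fin N} → x₀ < i →
              Σ (Fin N) λ c → c < i × (∀ x → x < i → value x ℕ.≤ value c)
  prefixMax {i = i} = argmax-on value {λ x → x < i} (Fin._<? i)

  suffixMin : ∀ {j y₀ : Fin N} → j < y₀ →
              Σ (Fin N) λ c → j < c × (∀ y → j < y → value c ℕ.≤ value y)
  suffixMin {j} = argmin-on value {λ y → j < y} (j Fin.<?_)

  prefixMax⇒LRMax : ∀ {c i : Fin N} → c < i → (∀ x → x < i → value x ℕ.≤ value c) → IsLRMax π c
  prefixMax⇒LRMax c<i max x x<c = value-≤∧≢⇒< (Fin.<⇒≢ x<c) (max x (ℕ.<-trans x<c c<i))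

  suffixMin⇒RLMin : ∀ {j c : Fin N} → j < c → (∀ y → j < y → value c ℕ.≤ value y) → IsRLMin π c
  suffixMin⇒RLMin j<c min y c<y = value-≤∧≢⇒< (Fin.<⇒≢ c<y) (min y (ℕ.<-trans j<c c<y))

  LRMax-predecessor : ∀ {x i : Fin N} → x < i → IsLRMax π i → Σ (Fin N) λ c → ConsecLRMax π c i
  LRMax-predecessor {x} {i} x<i lr =
    let c , c<i , max = prefixMax {x} {i} x<i
    in c , prefixMax⇒LRMax c<i max , lr , c<i , λ m c<m m<i lr-m → ℕ.<⇒≱ (lr-m c c<m) (max m m<i)

  RLMin-successor : ∀ {j y : Fin N} → j < y → IsRLMin π j → Σ (Fin N) λ c → ConsecRLMin π j c
  RLMin-successor {j} {y} j<y rl =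
    let c , j<c , min = suffixMin {j} {y} j<y
    in c , rl , suffixMin⇒RLMin j<c min , j<c , λ m j<m m<c rl-m → ℕ.<⇒≱ (rl-m c m<c) (min m j<m)

  -- The maximum of the prefix before i′ is a left-to-right maximum, hence it is i.
  ConsecLRMax-bound : ∀ {i i′ : Fin N} → ConsecLRMax π i i′ → ∀ x → x < i′ → value x ℕ.≤ value i
  ConsecLRMax-bound {i} {i′} (lr , _ , i<i′ , none) x x<i′ with prefixMax {i} {i′} i<i′
  ... | c , c<i′ , max with Fin.<-cmp c i
  ...   | tri< c<i _ _ = ⊥-elim (ℕ.<⇒≱ (lr c c<i) (max i i<i′))
  ...   | tri≈ _ refl _ = max x x<i′
  ...   | tri> _ _ i<c = ⊥-elim (none c i<c c<i′ (prefixMax⇒LRMax c<i′ max))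

  ConsecRLMin-bound : ∀ {j j′ : Fin N} → ConsecRLMin π j j′ → ∀ y → j < y → value j′ ℕ.≤ value y
  ConsecRLMin-bound {j} {j′} (_ , rl′ , j<j′ , none) y j<y with suffixMin {j} {j′} j<j′
  ... | c , j<c , min with Fin.<-cmp c j′
  ...   | tri< c<j′ _ _ = ⊥-elim (none c j<c c<j′ (suffixMin⇒RLMin j<c min))
  ...   | tri≈ _ refl _ = min y j<y
  ...   | tri> _ _ j′<c = ⊥-elim (ℕ.<⇒≱ (rl′ c j′<c) (min j′ j<j′))

  ConsecLRMax-unique : ∀ {i₁ i₂ i′ : Fin N} → ConsecLRMax π i₁ i′ → ConsecLRMax π i₂ i′ → i₁ ≡ i₂
  ConsecLRMax-unique {i₁} {i₂} (lr₁ , _ , i₁<i′ , none₁) (lr₂ , _ , i₂<i′ , none₂) = Fin.≤-antisym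
    (ℕ.≮⇒≥ λ i₂<i₁ → none₂ i₁ i₂<i₁ i₁<i′ lr₁)
    (ℕ.≮⇒≥ λ i₁<i₂ → none₁ i₂ i₁<i₂ i₂<i′ lr₂)

  ConsecRLMin-unique : ∀ {j j₁ j₂ : Fin N} → ConsecRLMin π j j₁ → ConsecRLMin π j j₂ → j₁ ≡ j₂
  ConsecRLMin-unique {j} {j₁} {j₂} (_ , rl₁ , j<j₁ , none₁) (_ , rl₂ , j<j₂ , none₂) = Fin.≤-antisym
    (ℕ.≮⇒≥ λ j₂<j₁ → none₁ j₂ j<j₂ j₂<j₁ rl₂)
    (ℕ.≮⇒≥ λ j₁<j₂ → none₂ j₁ j<j₁ j₁<j₂ rl₁)

  ConsecLRMax-ordered : ∀ {i₁ i₁′ i₂ i₂′ : Fin N} → ConsecLRMax π i₁ i₁′ → ConsecLRMax π i₂ i₂′ →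
                        i₁′ < i₂′ → i₁′ ≤ i₂
  ConsecLRMax-ordered {i₁′ = i₁′} {i₂} (_ , lr₁′ , _ , _) (_ , _ , _ , none₂) i₁′<i₂′ =
    ℕ.≮⇒≥ λ i₂<i₁′ → none₂ i₁′ i₂<i₁′ i₁′<i₂′ lr₁′

  ConsecRLMin-ordered : ∀ {j₁ j₁′ j₂ j₂′ : Fin N} → ConsecRLMin π j₁ j₁′ → ConsecRLMin π j₂ j₂′ →
                        j₁ < j₂ → j₁′ ≤ j₂
  ConsecRLMin-ordered {j₁′ = j₁′} {j₂} (_ , _ , _ , none₁) (rl₂ , _ , _ , _) j₁<j₂ =
    ℕ.≮⇒≥ λ j₂<j₁′ → none₁ j₂ j₁<j₂ j₂<j₁′ rl₂

  occurrence₄ : (τ τ⁻¹ : Fin 4 → Fin 4) → (∀ a → τ⁻¹ (τ a) ≡ a) → (x₀ x₁ x₂ x₃ : Fin N) →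
                x₀ < x₁ → x₁ < x₂ → x₂ < x₃ →
                let h i = value (Vec.lookup (x₀ ∷ x₁ ∷ x₂ ∷ x₃ ∷ []) (τ⁻¹ i)) in
                h (# 0) ℕ.< h (# 1) → h (# 1) ℕ.< h (# 2) → h (# 2) ℕ.< h (# 3) → Contains π τ
  occurrence₄ τ τ⁻¹ τ⁻¹∘τ x₀ x₁ x₂ x₃ x₀<x₁ x₁<x₂ x₂<x₃ h₀<h₁ h₁<h₂ h₂<h₃ =
    occurrence π τ τ⁻¹ τ⁻¹∘τ (Vec.lookup xs) (ascending₄ (toℕ ∘ Vec.lookup xs) x₀<x₁ x₁<x₂ x₂<x₃)
      (ascending₄ (value ∘ Vec.lookup xs ∘ τ⁻¹) h₀<h₁ h₁<h₂ h₂<h₃)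
    where xs = x₀ ∷ x₁ ∷ x₂ ∷ x₃ ∷ []

p2341⁻¹ p4123⁻¹ p3412⁻¹ : Fin 4 → Fin 4
p2341⁻¹ = Vec.lookup (# 3 ∷ # 0 ∷ # 1 ∷ # 2 ∷ [])
p4123⁻¹ = Vec.lookup (# 1 ∷ # 2 ∷ # 3 ∷ # 0 ∷ [])
p3412⁻¹ = Vec.lookup (# 2 ∷ # 3 ∷ # 0 ∷ # 1 ∷ [])

p2341⁻¹∘p2341 : ∀ a → p2341⁻¹ (p2341 a) ≡ a
p2341⁻¹∘p2341 = from-yes (Fin.all? λ a → p2341⁻¹ (p2341 a) Fin.≟ a)

p4123⁻¹∘p4123 : ∀ a → p4123⁻¹ (p4123 a) ≡ a
p4123⁻¹∘p4123 = from-yes (Fin.all? λ a → p4123⁻¹ (p4123 a) Fin.≟ a)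

p3412⁻¹∘p3412 : ∀ a → p3412⁻¹ (p3412 a) ≡ a
p3412⁻¹∘p3412 = from-yes (Fin.all? λ a → p3412⁻¹ (p3412 a) Fin.≟ a)

module Indecomposable {N} (π : Permutation′ N) (indecomposable : SumIndecomposable π) where

  open Records π

  no-weak-cut : ∀ k → 1 ℕ.≤ k → k ℕ.< N →
                ¬ (∀ x y → toℕ x ℕ.< k → k ℕ.≤ toℕ y → value x ℕ.≤ value y)
  no-weak-cut k 1≤k k<N weak = indecomposable (cut⇒sumDecomposable π k 1≤k k<N λ x y x<k k≤y →
    value-≤∧≢⇒< (λ x≡y → ℕ.<⇒≱ x<k (subst (λ z → k ℕ.≤ toℕ z) (sym x≡y) k≤y)) (weak x y x<k k≤y))

  no-weak-cut-at : ∀ {i c : Fin N} → i < c → ¬ (∀ x y → x < c → c ≤ y → value x ℕ.≤ value y)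
  no-weak-cut-at {c = c} i<c = no-weak-cut (toℕ c) (ℕ.≤-trans (s≤s z≤n) i<c) (Fin.toℕ<n c)

  LRMax∧RLMin⇒first : ∀ {i c : Fin N} → i < c → IsLRMax π c → IsRLMin π c → ⊥
  LRMax∧RLMin⇒first i<c lr rl = no-weak-cut-at i<c λ x y x<c c≤y →
    ℕ.<⇒≤ (ℕ.<-≤-trans (lr x x<c) (RLMin-mono rl c≤y))

  RLMin-between-ConsecLRMax : Avoids π p2341 → ∀ {x₀ a b : Fin N} → ConsecLRMax π a b → x₀ < a →
                              Σ (Fin N) λ j → a < j × j < b × IsRLMin π j
  RLMin-between-ConsecLRMax avoids {x₀} {a} {b} (lr-a , lr-b , a<b , _) x₀<a
    with prefixMax {x₀} {a} x₀<a | suffixMin {a} {b} a<b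
  ... | c , c<a , max | m , a<m , min with value m ℕ.<? value c
  ...   | no m≮c = ⊥-elim (no-weak-cut-at x₀<a λ x y x<a a≤y → ℕ.≤-trans (max x x<a) (c≤ y a≤y))
    where
      c≤ : ∀ y → a ≤ y → value c ℕ.≤ value y
      c≤ y a≤y = [ (λ a<y → ℕ.≤-trans (ℕ.≮⇒≥ m≮c) (min y a<y))
                 , (λ { refl → ℕ.<⇒≤ (lr-a c c<a) }) ]′ (≤⇒<⊎≡ a≤y)
  ...   | yes m<c with Fin.<-cmp m b
  ...     | tri< m<b _ _ = m , a<m , m<b , suffixMin⇒RLMin a<m min
  ...     | tri≈ _ refl _ = ⊥-elim (ℕ.<-asym m<c (ℕ.<-trans (lr-a c c<a) (lr-b a a<b)))
  ...     | tri> _ _ b<m = ⊥-elim (avoids (occurrence₄ p2341 p2341⁻¹ p2341⁻¹∘p2341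
                                             c a b m c<a a<b b<m m<c (lr-a c c<a) (lr-b a a<b)))

  LRMax-between-ConsecRLMin : Avoids π p4123 → ∀ {j j′ y₀ : Fin N} → ConsecRLMin π j j′ → j′ < y₀ →
                              Σ (Fin N) λ i → j < i × i < j′ × IsLRMax π i
  LRMax-between-ConsecRLMin avoids {j} {j′} {y₀} (rl-j , rl-j′ , j<j′ , _) j′<y₀
    with suffixMin {j′} {y₀} j′<y₀ | prefixMax {j} {j′} j<j′
  ... | c , j′<c , min | M , M<j′ , max with value c ℕ.<? value M
  ...   | no c≮M = ⊥-elim (no-weak-cut (suc (toℕ j′)) (s≤s z≤n) (ℕ.≤-<-trans j′<c (Fin.toℕ<n c))
                             λ x y x≤j′ j′<y → ℕ.≤-trans (≤c x (ℕ.s≤s⁻¹ x≤j′)) (min y j′<y))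
    where
      ≤c : ∀ x → x ≤ j′ → value x ℕ.≤ value c
      ≤c x x≤j′ = [ (λ x<j′ → ℕ.≤-trans (max x x<j′) (ℕ.≮⇒≥ c≮M))
                  , (λ { refl → ℕ.<⇒≤ (rl-j′ c j′<c) }) ]′ (≤⇒<⊎≡ x≤j′)
  ...   | yes c<M with Fin.<-cmp j M
  ...     | tri< j<M _ _ = M , j<M , M<j′ , prefixMax⇒LRMax M<j′ max
  ...     | tri≈ _ refl _ = ⊥-elim (ℕ.<-asym c<M (ℕ.<-trans (rl-j j′ j<j′) (rl-j′ c j′<c)))
  ...     | tri> _ _ M<j = ⊥-elim (avoids (occurrence₄ p4123 p4123⁻¹ p4123⁻¹∘p4123
                                             M j j′ c M<j j<j′ j′<c
                                             (rl-j j′ j<j′) (rl-j′ c j′<c) c<M))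

  inflection-determined-by-abscissa :
    (κ κ′ : Kind) (p q : Point N) → Inflection π κ p → Inflection π κ′ q →
    proj₁ p ≡ proj₁ q → (κ ≡ κ′) × (p ≡ q)
  inflection-determined-by-abscissa LRmax LRmax _ _
    (_ , i′ , cons₁ , refl , refl) (_ , _ , cons₂ , refl , refl) refl =
    refl , cong (λ i → i′ , π ⟨$⟩ʳ i) (ConsecLRMax-unique cons₁ cons₂)
  inflection-determined-by-abscissa RLmin RLmin _ _
    (j , _ , cons₁ , refl , refl) (_ , _ , cons₂ , refl , refl) refl =
    refl , cong (λ j′ → j , π ⟨$⟩ʳ j′) (ConsecRLMin-unique cons₁ cons₂)
  inflection-determined-by-abscissa LRmax RLmin _ _
    (_ , _ , (_ , lr , i<i′ , _) , refl , refl) (_ , _ , (rl , _) , refl , refl) refl =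
    ⊥-elim (LRMax∧RLMin⇒first i<i′ lr rl)
  inflection-determined-by-abscissa RLmin LRmax _ _
    (_ , _ , (rl , _) , refl , refl) (_ , _ , (_ , lr , i<i′ , _) , refl , refl) refl =
    ⊥-elim (LRMax∧RLMin⇒first i<i′ lr rl)

  inflections-increasing :
    Avoids π p3412 →
    (κ κ′ : Kind) (p q : Point N) → Inflection π κ p → Inflection π κ′ q →
    proj₁ p < proj₁ q → proj₂ p < proj₂ q
  inflections-increasing _ LRmax LRmax _ _
    (i₁ , _ , cons₁@(_ , lr₁′ , i₁<i₁′ , _) , refl , refl)
    (_ , _ , cons₂@(lr₂ , _) , refl , refl) i₁′<i₂′ =
    ℕ.<-≤-trans (lr₁′ i₁ i₁<i₁′) (LRMax-mono lr₂ (ConsecLRMax-ordered cons₁ cons₂ i₁′<i₂′))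
  inflections-increasing _ RLmin RLmin _ _
    (_ , _ , cons₁@(_ , rl₁′ , _) , refl , refl)
    (_ , j₂′ , cons₂@(rl₂ , _ , j₂<j₂′ , _) , refl , refl) j₁<j₂ =
    ℕ.≤-<-trans (RLMin-mono rl₁′ (ConsecRLMin-ordered cons₁ cons₂ j₁<j₂)) (rl₂ j₂′ j₂<j₂′)
  inflections-increasing avoids LRmax RLmin _ _
    (i , i′ , (_ , lr′ , i<i′ , _) , refl , refl) (j , j′ , (rl , _ , j<j′ , _) , refl , refl) i′<j
    with value i ℕ.<? value j′
  ... | yes i<j′ = i<j′
  ... | no i≮j′ = ⊥-elim (avoids (occurrence₄ p3412 p3412⁻¹ p3412⁻¹∘p3412 i i′ j j′ i<i′ i′<j j<j′
                                     (rl j′ j<j′) (value-≤∧≢⇒< j′≢i (ℕ.≮⇒≥ i≮j′)) (lr′ i i<i′)))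
    where
      j′≢i : j′ ≢ i
      j′≢i j′≡i = Fin.<⇒≢ (ℕ.<-trans i<i′ (ℕ.<-trans i′<j j<j′)) (sym j′≡i)
  inflections-increasing _ RLmin LRmax _ _
    (_ , j′ , cons-j , refl , refl) (i , i′ , cons-i@(_ , _ , i<i′ , _) , refl , refl) j<i′
    with value j′ ℕ.<? value i
  ... | yes j′<i = j′<i
  ... | no j′≮i = ⊥-elim (no-weak-cut-at i<i′ λ x y x<i′ i′≤y →
          ℕ.≤-trans (ConsecLRMax-bound cons-i x x<i′)
                    (ℕ.≤-trans (ℕ.≮⇒≥ j′≮i) (ConsecRLMin-bound cons-j y (ℕ.<-≤-trans j<i′ i′≤y))))

  inflections-alternate :
    Avoids π p2341 → Avoids π p4123 →
    (κ κ′ : Kind) (p q : Point N) → Inflection π κ p → Inflection π κ′ q →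
    proj₁ p < proj₁ q →
    ((μ : Kind) (r : Point N) → Inflection π μ r → proj₁ p < proj₁ r → proj₁ r < proj₁ q → ⊥) →
    κ ≢ κ′
  inflections-alternate _ _ LRmax RLmin _ _ _ _ _ _ ()
  inflections-alternate _ _ RLmin LRmax _ _ _ _ _ _ ()
  inflections-alternate avoids _ LRmax LRmax _ _
    (_ , _ , cons₁@(_ , _ , i₁<i₁′ , _) , refl , refl) (_ , _ , cons₂ , refl , refl) i₁′<i₂′ none _
    with ConsecLRMax-ordered cons₁ cons₂ i₁′<i₂′
  ... | i₁′≤i₂ with RLMin-between-ConsecLRMax avoids cons₂ (ℕ.<-≤-trans i₁<i₁′ i₁′≤i₂)
  ...   | j , i₂<j , j<i₂′ , rl with RLMin-successor j<i₂′ rl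
  ...     | j′ , cons = none RLmin (j , π ⟨$⟩ʳ j′) (j , j′ , cons , refl , refl)
                            (ℕ.≤-<-trans i₁′≤i₂ i₂<j) j<i₂′
  inflections-alternate _ avoids RLmin RLmin _ _
    (_ , _ , cons₁ , refl , refl) (_ , _ , cons₂@(_ , _ , j₂<j₂′ , _) , refl , refl) j₁<j₂ none _
    with ConsecRLMin-ordered cons₁ cons₂ j₁<j₂
  ... | j₁′≤j₂ with LRMax-between-ConsecRLMin avoids cons₁ (ℕ.≤-<-trans j₁′≤j₂ j₂<j₂′)
  ...   | i , j₁<i , i<j₁′ , lr with LRMax-predecessor j₁<i lr
  ...     | i₀ , cons = none LRmax (i , π ⟨$⟩ʳ i₀) (i₀ , i , cons , refl , refl)
                            j₁<i (ℕ.<-≤-trans i<j₁′ j₁′≤j₂)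

lemma7 : ∀ {N} (π : Permutation′ N) → SumIndecomposable π →
    Avoids π p2341 → Avoids π p4123 → Avoids π p3412 →
    ((κ κ′ : Kind) (p q : Point N) → Inflection π κ p → Inflection π κ′ q →
      proj₁ p ≡ proj₁ q → (κ ≡ κ′) × (p ≡ q))
    × ((κ κ′ : Kind) (p q : Point N) → Inflection π κ p → Inflection π κ′ q →
      proj₁ p < proj₁ q → proj₂ p < proj₂ q)
    × ((κ κ′ : Kind) (p q : Point N) → Inflection π κ p → Inflection π κ′ q →
      proj₁ p < proj₁ q →
      ((μ : Kind) (r : Point N) → Inflection π μ r →
        proj₁ p < proj₁ r → proj₁ r < proj₁ q → ⊥) →
      κ ≢ κ′)
lemma7 π indecomposable avoids2341 avoids4123 avoids3412 =
    inflection-determined-by-abscissa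
  , inflections-increasing avoids3412
  , inflections-alternate avoids2341 avoids4123
  where open Indecomposable π indecomposable
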